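{- Let $G=(X,Y,E)$ be a connected chain graph with proper ordered chain partition $X_1,\dots,X_k$, $Y_1,\dots,Y_k$ and $k\ge 2$. If $X$ contains more than one pendent vertex, then every cosecure dominating set $S$ of $G$ contains $X_1$ and does not contain $y_{11}$.
   Context: All graphs are finite, simple, undirected, without isolated vertices. A set $S$ of vertices is a cosecure dominating set if every vertex outside $S$ has a neighbour in $S$ and for every $u\in S$ there is a neighbour $v\notin S$ of $u$ such that $(S\setminus\{u\})\cup\{v\}$ is still dominating. A pendent vertex is a vertex of degree $1$. A bipartite graph $G=(X,Y,E)$ is a chain graph if $X$ can be ordered $x_1,\dots,x_{n_1}$ with $N(x_1)\subseteq N(x_2)\subseteq\cdots\subseteq N(x_{n_1})$. Partition $X$ into classes of the equivalence relation $x\sim x'\iff N(x)=N(x')$, indexed $X_1,\dots,X_k$ so that $N(X_1)\subsetneq N(X_2)\subsetneq\cdots\subsetneq N(X_k)$, where $N(X_i)$ is the common neighbourhood of the vertices of $X_i$. Set $Y_1=N(X_1)$ and $Y_i=N(X_i)\setminus\bigcup_{j<i}N(X_j)$ for $2\le i\le k$; then $Y_1,\dots,Y_k$ partition $Y$, and $X_1,\dots,X_k,Y_1,\dots,Y_k$ is the proper ordered chain partition. Vertices are written $X_i=\{x_{i1},x_{i2},\dots\}$, $Y_i=\{y_{i1},y_{i2},\dots\}$. -}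

module Defs where

open import Data.Nat using (ℕ; zero; suc; _<_)
open import Data.Fin using (Fin) renaming (_≤_ to _≤ᶠ_)
open import Data.Fin.Subset using (Subset; _∈_; _∉_; _⊆_; _⊂_; _─_; _∪_; ⁅_⁆; ∣_∣)
open import Data.Bool using (Bool; true; false)
open import Data.Vec using (tabulate)
open import Data.Product using (Σ; _×_; ∃; ∃-syntax)
open import Data.Sum using (_⊎_)
open import Relation.Binary.PropositionalEquality using (_≡_)
open import Relation.Nullary using (¬_)
open import Function.Definitions using (Injective)
open import Function.Bundles using (_⇔_)

record Graph : Set where
  field
    n     : ℕ
    adj   : Fin n → Fin n → Bool
    sym   : ∀ u v → adj u v ≡ adj v u
    irrefl : ∀ u → adj u u ≡ false

module _ (G : Graph) where
  open Graph G

  Adj : Fin n → Fin n → Set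
  Adj u v = adj u v ≡ true

  N : Fin n → Subset n
  N u = tabulate (adj u)

  degree : Fin n → ℕ
  degree u = ∣ N u ∣

  Pendent : Fin n → Set
  Pendent u = degree u ≡ 1

  NoIsolated : Set
  NoIsolated = ∀ v → ∃[ u ] Adj u v

  data Reach : Fin n → Fin n → Set where
    here : ∀ {u} → Reach u u
    step : ∀ {u v w} → Adj u v → Reach v w → Reach u w

  Connected : Set
  Connected = ∀ u v → Reach u v

  -- G = (X, Y, E) bipartite with bipartition X, Y = complement of X
  IsBipartition : Subset n → Set
  IsBipartition X = ∀ u v → Adj u v → (u ∈ X × v ∉ X) ⊎ (u ∉ X × v ∈ X)

  IsChain : Subset n → Set
  IsChain X = Σ ℕ λ m → Σ (Fin m → Fin n) λ ord →
      Injective _≡_ _≡_ ord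
    × (∀ i → ord i ∈ X)
    × (∀ x → x ∈ X → ∃[ i ] ord i ≡ x)
    × (∀ i j → i ≤ᶠ j → N (ord i) ⊆ N (ord j))

  Dominating : Subset n → Set
  Dominating S = ∀ v → v ∉ S → ∃[ u ] (u ∈ S × Adj u v)

  Cosecure : Subset n → Set
  Cosecure S = Dominating S ×
    (∀ u → u ∈ S → ∃[ v ] (v ∉ S × Adj u v × Dominating ((S ─ ⁅ u ⁆) ∪ ⁅ v ⁆)))

  -- The proper ordered chain partition with k classes: cls x = i - 1 means x ∈ X_i
  -- (classes are indexed 0, ..., k-1 here, so X_1 is class 0).
  record ProperOrderedChainPartition (X : Subset n) (k : ℕ) : Set where
    field
      cls       : Fin n → ℕ
      cls-bound : ∀ x → x ∈ X → cls x < k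
      cls-onto  : ∀ i → i < k → ∃[ x ] (x ∈ X × cls x ≡ i)
      cls-equiv : ∀ x x' → x ∈ X → x' ∈ X → (cls x ≡ cls x' ⇔ N x ≡ N x')
      cls-order : ∀ x x' → x ∈ X → x' ∈ X → cls x < cls x' → N x ⊂ N x'

    X₁ : Fin n → Set
    X₁ x = x ∈ X × cls x ≡ 0

    Y₁ : Fin n → Set
    Y₁ y = ∀ x → X₁ x → y ∈ N x

-- A pendent vertex x of X lies in X₁: otherwise N(X₁) ⊊ N(x), a nonempty proper
-- subset of a singleton. Hence X₁, which has the same neighbourhood as x, consists of
-- pendent vertices sharing one neighbour q, and Y₁ = {q}. Two pendent vertices at q
-- keep q out of every cosecure dominating set S: after swapping q for some v, one of
-- them is still dominated only through q, so it lies in S, yet its own swap partner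
-- would then have to be q ∉ S. With q ∉ S, domination forces all of X₁ into S.
module Submission where

open import Defs
open import Data.Nat using (ℕ; zero; suc; _≤_; _<_; s≤s; z≤n)
open import Data.Nat.Properties using (<-irrefl; ≤-trans; ≤-<-trans)
open import Data.Fin as Fin using (Fin; _≟_)
open import Data.Fin.Subset
  using (Subset; _∈_; _∉_; _⊆_; _⊂_; _⊄_; _─_; _∪_; ⁅_⁆; ∣_∣; Nonempty; inside; outside)
open import Data.Fin.Subset.Properties
  using (_∈?_; x∈⁅x⁆; x∈⁅y⁆⇒x≡y; ∣⁅x⁆∣≡1; x∈p∪q⁻; p⊆q⇒∣p∣≤∣q∣; p⊂q⇒∣p∣<∣q∣)
open import Data.Vec using (_∷_; here; there; tabulate)
open import Data.Vec.Properties using (lookup∘tabulate; []=⇒lookup; lookup⇒[]=)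
open import Data.Product using (_×_; ∃-syntax; _,_; proj₁; proj₂)
open import Data.Sum using (inj₁; inj₂)
open import Relation.Nullary using (yes; no; contradiction)
open import Relation.Binary.PropositionalEquality
  using (_≡_; _≢_; refl; sym; trans; subst; subst₂)
open import Function.Bundles using (Equivalence)

module _ {m : ℕ} where

  x∈p⇒⁅x⁆⊆p : ∀ {x} {p : Subset m} → x ∈ p → ⁅ x ⁆ ⊆ p
  x∈p⇒⁅x⁆⊆p {x} x∈p y∈⁅x⁆ = subst (_∈ _) (sym (x∈⁅y⁆⇒x≡y x y∈⁅x⁆)) x∈p

  ∣q∣≡1⇒nonempty⊄q : ∀ {p q : Subset m} → ∣ q ∣ ≡ 1 → Nonempty p → p ⊄ q
  ∣q∣≡1⇒nonempty⊄q {p} {q} ∣q∣≡1 (x , x∈p) p⊂q = <-irrefl refl 1<1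
    where
    1≤∣p∣ : 1 ≤ ∣ p ∣
    1≤∣p∣ = subst (_≤ ∣ p ∣) (∣⁅x⁆∣≡1 x) (p⊆q⇒∣p∣≤∣q∣ (x∈p⇒⁅x⁆⊆p x∈p))
    1<1 : 1 < 1
    1<1 = subst (1 <_) ∣q∣≡1 (≤-<-trans 1≤∣p∣ (p⊂q⇒∣p∣<∣q∣ p⊂q))

  ∣p∣≡1⇒∈-unique : ∀ {p : Subset m} {x y} → ∣ p ∣ ≡ 1 → x ∈ p → y ∈ p → x ≡ y
  ∣p∣≡1⇒∈-unique {p} {x} {y} ∣p∣≡1 x∈p y∈p with x ≟ y
  ... | yes x≡y = x≡y
  ... | no x≢y = contradiction ⁅x⁆⊂p (∣q∣≡1⇒nonempty⊄q ∣p∣≡1 (x , x∈⁅x⁆ x))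
    where
    ⁅x⁆⊂p : ⁅ x ⁆ ⊂ p
    ⁅x⁆⊂p = x∈p⇒⁅x⁆⊆p x∈p , y , y∈p , λ y∈⁅x⁆ → x≢y (sym (x∈⁅y⁆⇒x≡y x y∈⁅x⁆))

x∈p─q⁻ : ∀ {m} (p q : Subset m) {x} → x ∈ p ─ q → x ∈ p × x ∉ q
x∈p─q⁻ (inside ∷ p) (outside ∷ q) here = here , λ ()
x∈p─q⁻ (_ ∷ p) (inside ∷ q) {Fin.zero} ()
x∈p─q⁻ (outside ∷ p) (outside ∷ q) {Fin.zero} ()
x∈p─q⁻ (_ ∷ p) (_ ∷ q) (there x∈p─q) with x∈p─q⁻ p q x∈p─q
... | x∈p , x∉q = there x∈p , λ { (there x∈q) → x∉q x∈q }

x∈swap⇒x∈p : ∀ {m} (p : Subset m) {x y z} → x ≢ z → x ∈ (p ─ ⁅ y ⁆) ∪ ⁅ z ⁆ → x ∈ p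
x∈swap⇒x∈p p {y = y} {z} x≢z x∈swap with x∈p∪q⁻ (p ─ ⁅ y ⁆) ⁅ z ⁆ x∈swap
... | inj₁ x∈p─y = proj₁ (x∈p─q⁻ p ⁅ y ⁆ x∈p─y)
... | inj₂ x∈⁅z⁆ = contradiction (x∈⁅y⁆⇒x≡y z x∈⁅z⁆) x≢z

y∉swap : ∀ {m} (p : Subset m) {y z} → y ≢ z → y ∉ (p ─ ⁅ y ⁆) ∪ ⁅ z ⁆
y∉swap p {y} {z} y≢z y∈swap with x∈p∪q⁻ (p ─ ⁅ y ⁆) ⁅ z ⁆ y∈swap
... | inj₁ y∈p─y = proj₂ (x∈p─q⁻ p ⁅ y ⁆ y∈p─y) (x∈⁅x⁆ y)
... | inj₂ y∈⁅z⁆ = y≢z (x∈⁅y⁆⇒x≡y z y∈⁅z⁆)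

module _ (G : Graph) where
  open Graph G using (adj; irrefl) renaming (sym to adj-sym)

  Adj⇒∈N : ∀ {u v} → Adj G u v → v ∈ N G u
  Adj⇒∈N {u} {v} uv = lookup⇒[]= v (tabulate (adj u)) (trans (lookup∘tabulate (adj u) v) uv)

  ∈N⇒Adj : ∀ {u v} → v ∈ N G u → Adj G u v
  ∈N⇒Adj {u} {v} v∈N = trans (sym (lookup∘tabulate (adj u) v)) ([]=⇒lookup v∈N)

  Adj-sym : ∀ {u v} → Adj G u v → Adj G v u
  Adj-sym {u} {v} uv = trans (adj-sym v u) uv

  Adj⇒≢ : ∀ {u v} → Adj G u v → u ≢ v
  Adj⇒≢ {u} uv refl with trans (sym uv) (irrefl u)
  ... | ()

  Pendent⇒Adj-unique : ∀ {x u v} → Pendent G x → Adj G x u → Adj G x v → u ≡ v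
  Pendent⇒Adj-unique {x} deg≡1 xu xv = ∣p∣≡1⇒∈-unique {p = N G x} deg≡1 (Adj⇒∈N xu) (Adj⇒∈N xv)

  Dominating⇒pendent∈ : ∀ {S x q} → Dominating G S → Pendent G x → Adj G x q → q ∉ S → x ∈ S
  Dominating⇒pendent∈ {S} {x} dom px xq q∉S with x ∈? S
  ... | yes x∈S = x∈S
  ... | no x∉S with dom x x∉S
  ... | u , u∈S , ux = contradiction (subst (_∈ S) (Pendent⇒Adj-unique px (Adj-sym ux) xq) u∈S) q∉S

  Cosecure⇒pendent∈⇒support∉ : ∀ {S x q} → Cosecure G S → Pendent G x → Adj G x q → x ∈ S → q ∉ S
  Cosecure⇒pendent∈⇒support∉ {S} (_ , swap) px xq x∈S q∈S with swap _ x∈S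
  ... | v , v∉S , xv , _ = v∉S (subst (_∈ S) (Pendent⇒Adj-unique px xq xv) q∈S)

  Dominating-swap⇒pendent∈ : ∀ {S q v x} → Adj G q v → Dominating G ((S ─ ⁅ q ⁆) ∪ ⁅ v ⁆) →
    x ≢ v → Pendent G x → Adj G x q → x ∈ S
  Dominating-swap⇒pendent∈ {S} qv dom' x≢v px xq =
    x∈swap⇒x∈p S x≢v (Dominating⇒pendent∈ dom' px xq (y∉swap S (Adj⇒≢ qv)))

  Cosecure⇒support∉ : ∀ {S x x' q} → Cosecure G S → x ≢ x' →
    Pendent G x → Pendent G x' → Adj G x q → Adj G x' q → q ∉ S
  Cosecure⇒support∉ {S} {x} {x'} {q} cos@(_ , swap) x≢x' px px' xq x'q q∈S with swap q q∈S
  ... | v , _ , qv , dom' with x ≟ v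
  ...   | yes refl = Cosecure⇒pendent∈⇒support∉ cos px' x'q
                       (Dominating-swap⇒pendent∈ qv dom' (λ x'≡x → x≢x' (sym x'≡x)) px' x'q) q∈S
  ...   | no x≢v = Cosecure⇒pendent∈⇒support∉ cos px xq (Dominating-swap⇒pendent∈ qv dom' x≢v px xq) q∈S

module _ {G : Graph} {X : Subset (Graph.n G)} {k : ℕ} (P : ProperOrderedChainPartition G X k) where
  open ProperOrderedChainPartition P

  X₁⇒N≡ : ∀ {x x'} → X₁ x → X₁ x' → N G x ≡ N G x'
  X₁⇒N≡ {x} {x'} (x∈X , cls≡0) (x'∈X , cls'≡0) =
    Equivalence.to (cls-equiv x x' x∈X x'∈X) (trans cls≡0 (sym cls'≡0))

  pendent⇒X₁ : ∀ {x} → NoIsolated G → 0 < k → x ∈ X → Pendent G x → X₁ x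
  pendent⇒X₁ {x} noIsolated 0<k x∈X px with cls x in cls≡
  ... | zero = x∈X , refl
  ... | suc _ with cls-onto 0 0<k
  ...   | x₀ , x₀∈X , cls₀≡ with noIsolated x₀
  ...     | u , ux₀ = contradiction (cls-order x₀ x x₀∈X x∈X cls₀<cls)
                        (∣q∣≡1⇒nonempty⊄q px (u , Adj⇒∈N G (Adj-sym G ux₀)))
    where
    cls₀<cls : cls x₀ < cls x
    cls₀<cls = subst₂ _<_ (sym cls₀≡) (sym cls≡) (s≤s z≤n)

mainTheorem12 : (G : Graph) → NoIsolated G → Connected G →
    (X : Subset (Graph.n G)) → IsBipartition G X → IsChain G X →
    (k : ℕ) → (P : ProperOrderedChainPartition G X k) → 2 ≤ k →
    (∃[ x ] ∃[ x' ] (x ≢ x' × x ∈ X × x' ∈ X × Pendent G x × Pendent G x')) →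
    (S : Subset (Graph.n G)) → Cosecure G S →
    (∀ x → ProperOrderedChainPartition.X₁ P x → x ∈ S)
    × (∀ y → ProperOrderedChainPartition.Y₁ P y → y ∉ S)
mainTheorem12 G noIsolated _ X _ _ k P 2≤k (x , x' , x≢x' , x∈X , x'∈X , px , px') S cos@(dom , _) =
  X₁⊆S , Y₁⊆∁S
  where
  open ProperOrderedChainPartition P

  pendent⇒X₁′ : ∀ {z} → z ∈ X → Pendent G z → X₁ z
  pendent⇒X₁′ = pendent⇒X₁ P noIsolated (≤-trans (s≤s z≤n) 2≤k)

  x∈X₁ : X₁ x
  x∈X₁ = pendent⇒X₁′ x∈X px

  q : Fin (Graph.n G)
  q = proj₁ (noIsolated x)

  xq : Adj G x q
  xq = Adj-sym G (proj₂ (noIsolated x))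

  X₁⇒pendent-at-q : ∀ {z} → X₁ z → Pendent G z × Adj G z q
  X₁⇒pendent-at-q z∈X₁ with X₁⇒N≡ P z∈X₁ x∈X₁
  ... | Nz≡Nx = subst (λ s → ∣ s ∣ ≡ 1) (sym Nz≡Nx) px
              , ∈N⇒Adj G (subst (q ∈_) (sym Nz≡Nx) (Adj⇒∈N G xq))

  q∉S : q ∉ S
  q∉S = Cosecure⇒support∉ G cos x≢x' px px' xq
          (proj₂ (X₁⇒pendent-at-q (pendent⇒X₁′ x'∈X px')))

  X₁⊆S : ∀ z → X₁ z → z ∈ S
  X₁⊆S z z∈X₁ = let pz , zq = X₁⇒pendent-at-q z∈X₁ in Dominating⇒pendent∈ G dom pz zq q∉S

  Y₁⊆∁S : ∀ y → Y₁ y → y ∉ S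
  Y₁⊆∁S y y∈Y₁ = subst (_∉ S) (Pendent⇒Adj-unique G px xq (∈N⇒Adj G (y∈Y₁ x x∈X₁))) q∉S
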